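{- Let $\phi=\frac12(1+\sqrt5)$, $F_j$ the Fibonacci numbers ($F_1=F_2=1$), and $G_n(x)=\prod_{i=0}^{n-1}\left(1+x^{\phi^i}\right)$. For $n\ge1$, one can write $G_n(x)=T_1(x)+T_2(x)+\cdots+T_k(x)$, where each $T_i(x)$ has the form $c_1x^{a}+c_2x^{a+1}$ or $c_1x^a+c_2x^{a+1}+c_3x^{a+2}$ for some $a\in\mathbb{Z}[\phi]$ and positive integers $c_1,c_2$ (and $c_3$), and where the largest exponent of a term of $T_i(x)$ is less than the smallest exponent of a term of $T_{i+1}(x)$ for each $i$. Moreover, $k=F_{n+1}$. -}

module Defs where

open import Data.Nat as ℕ using (ℕ; zero; suc)
open import Data.Integer as ℤ using (ℤ; +_; 0ℤ; 1ℤ)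
open import Data.Product using (_×_; _,_; proj₁; proj₂)
open import Data.Sum using (_⊎_)
open import Data.Unit using (⊤)
open import Data.List using (List; []; _∷_; _++_; map; concatMap; length)
open import Relation.Nullary using (Dec; yes; no)
open import Relation.Binary.PropositionalEquality using (_≡_)
import Data.Product.Properties as ×P

fib : ℕ → ℕ
fib zero = zero
fib (suc zero) = 1
fib (suc (suc n)) = fib (suc n) ℕ.+ fib n

-- The ring ℤ[φ], φ = (1+√5)/2.  The pair (p , q) denotes p + q·φ.
-- Since φ is irrational, this representation is unique, so ≡ on pairs
-- is equality of the real numbers.

ℤφ : Set
ℤφ = ℤ × ℤ

_+φ_ : ℤφ → ℤφ → ℤφ
(p , q) +φ (r , s) = (p ℤ.+ r , q ℤ.+ s)

-φ_ : ℤφ → ℤφ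
-φ (p , q) = (ℤ.- p , ℤ.- q)

ι : ℤ → ℤφ
ι m = (m , 0ℤ)

-- multiplication by φ, using φ² = φ + 1:  φ(p + qφ) = q + (p+q)φ
φ* : ℤφ → ℤφ
φ* (p , q) = (q , p ℤ.+ q)

φ^ : ℕ → ℤφ
φ^ zero = (1ℤ , 0ℤ)
φ^ (suc i) = φ* (φ^ i)

_≟φ_ : (x y : ℤφ) → Dec (x ≡ y)
_≟φ_ = ×P.≡-dec ℤ._≟_ ℤ._≟_

-- Positivity of p + qφ as a real number.  Writing u = 2p + q we have
-- 2(p + qφ) = u + q√5, and u + q√5 > 0 iff one of the following holds.
IsPos : ℤφ → Set
IsPos (p , q) =
  let u = (+ 2) ℤ.* p ℤ.+ q in
     (0ℤ ℤ.< u × 0ℤ ℤ.≤ q)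
   ⊎ (0ℤ ℤ.≤ u × 0ℤ ℤ.< q)
   ⊎ (0ℤ ℤ.< u × q ℤ.< 0ℤ × (+ 5) ℤ.* (q ℤ.* q) ℤ.< u ℤ.* u)
   ⊎ (u ℤ.< 0ℤ × 0ℤ ℤ.< q × u ℤ.* u ℤ.< (+ 5) ℤ.* (q ℤ.* q))

_<φ_ : ℤφ → ℤφ → Set
x <φ y = IsPos (y +φ (-φ x))

-- Generalised polynomials: finite formal sums Σ c · x^e with c ∈ ℕ,
-- e ∈ ℤ[φ], represented as lists of (coefficient , exponent).

GPoly : Set
GPoly = List (ℕ × ℤφ)

_*P_ : GPoly → GPoly → GPoly
P *P Q = concatMap (λ t → map (λ s → (proj₁ t ℕ.* proj₁ s , proj₂ t +φ proj₂ s)) Q) P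

oneP : GPoly
oneP = (1 , (0ℤ , 0ℤ)) ∷ []

coeff : ℤφ → GPoly → ℕ
coeff e [] = 0
coeff e ((c , e') ∷ P) with e' ≟φ e
... | yes _ = c ℕ.+ coeff e P
... | no _ = coeff e P

G : ℕ → GPoly
G zero = oneP
G (suc n) = G n *P ((1 , (0ℤ , 0ℤ)) ∷ (1 , φ^ n) ∷ [])

data Coeffs : Set where
  two   : (c₁ c₂ : ℕ) → Coeffs
  three : (c₁ c₂ c₃ : ℕ) → Coeffs

record Block : Set where
  constructor block
  field
    base   : ℤφ
    coeffs : Coeffs
open Block public

PositiveCoeffs : Coeffs → Set
PositiveCoeffs (two c₁ c₂) = 0 ℕ.< c₁ × 0 ℕ.< c₂
PositiveCoeffs (three c₁ c₂ c₃) = 0 ℕ.< c₁ × 0 ℕ.< c₂ × 0 ℕ.< c₃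

blockPoly : Block → GPoly
blockPoly (block a (two c₁ c₂)) =
  (c₁ , a) ∷ (c₂ , a +φ ι (+ 1)) ∷ []
blockPoly (block a (three c₁ c₂ c₃)) =
  (c₁ , a) ∷ (c₂ , a +φ ι (+ 1)) ∷ (c₃ , a +φ ι (+ 2)) ∷ []

minExp : Block → ℤφ
minExp b = base b

maxExp : Block → ℤφ
maxExp (block a (two _ _)) = a +φ ι (+ 1)
maxExp (block a (three _ _ _)) = a +φ ι (+ 2)

sumBlocks : List Block → GPoly
sumBlocks [] = []
sumBlocks (b ∷ bs) = blockPoly b ++ sumBlocks bs

Separated : List Block → Set
Separated [] = ⊤
Separated (b ∷ []) = ⊤
Separated (b ∷ b' ∷ bs) = (maxExp b <φ minExp b') × Separated (b' ∷ bs)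

-- G (n + 1) (x) = (1 + x) · G n (x^φ).  Suppose G n is a chain of blocks c₁x^a + c₂x^(a+1)
-- (+ c₃x^(a+2)) in which each block starts at distance φ - 1 beyond the end of the previous one.
-- Substituting x^φ and multiplying by 1 + x sends a term c x^e to c x^(φe) + c x^(φe+1).  Inside a
-- block this yields exponents spaced 1, φ - 1, 1, ...; across a gap φ - 1 the exponent φe + 1 of
-- one image coincides with the exponent φ(e + φ - 1) of the next, because φ(φ - 1) = 1.  Merging
-- these coinciding terms exhibits G (n + 1) as a chain of blocks again (refine below).  A chain
-- with t two-term and h three-term blocks refines to one with h + 2 two-term and t + h - 1
-- three-term blocks, so the number of blocks obeys the Fibonacci recursion.

module Submission where

open import Defs
open import Data.Nat using (ℕ; suc; _≤_)
open import Data.List using (List; length)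
open import Data.List.Relation.Unary.All using (All)
open import Data.Product using (_×_; ∃-syntax)
open import Relation.Binary.PropositionalEquality using (_≡_)

open import Data.Integer as ℤ using (ℤ; 0ℤ; 1ℤ; -1ℤ)
import Data.Integer.Properties as ℤ
open import Data.Integer.Tactic.RingSolver using (solve-∀)
open import Data.List using ([]; _∷_; _++_; map; concatMap)
open import Data.List.Properties using (length-map)
open import Data.List.Relation.Unary.All using ([]; _∷_)
open import Data.List.Relation.Unary.All.Properties using (map⁻)
open import Data.Nat using (zero; _+_; _*_; _<_; z≤n; s≤s)
open import Data.Nat.Properties using (+-assoc; +-comm; +-suc; *-identityʳ; +-commutativeSemigroup; <-≤-trans; m≤m+n)
open import Algebra.Properties.CommutativeSemigroup +-commutativeSemigroup using (interchange; x∙yz≈y∙xz)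
open import Data.Product using (_,_; proj₁; proj₂; map₂)
open import Data.Sum using (inj₂)
open import Data.Unit using (tt)
open import Function using (id)
open import Relation.Binary.Bundles using (Setoid)
open import Relation.Binary.PropositionalEquality using (refl; sym; trans; cong; cong₂; subst; module ≡-Reasoning)
open import Relation.Nullary using (¬_; yes; no; contradiction)
import Relation.Binary.Reasoning.Setoid as SetoidReasoning

2ℤ : ℤ
2ℤ = ℤ.+ 2

0φ 1φ 2φ gap : ℤφ
0φ = ι 0ℤ
1φ = ι 1ℤ
2φ = ι 2ℤ
-- gap = φ - 1 = 1/φ separates consecutive blocks; multiplication by φ turns it into 1.
gap = (-1ℤ , 1ℤ)

_−φ_ : ℤφ → ℤφ → ℤφ
x −φ y = x +φ (-φ y)

φ⁻¹* : ℤφ → ℤφ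
φ⁻¹* (p , q) = (q ℤ.- p , p)

φ⁻¹*-φ* : ∀ x → φ⁻¹* (φ* x) ≡ x
φ⁻¹*-φ* (p , q) = cong (_, q) (eq p q)
  where
  eq : ∀ p q → (p ℤ.+ q) ℤ.- q ≡ p
  eq = solve-∀

φ*-φ⁻¹* : ∀ x → φ* (φ⁻¹* x) ≡ x
φ*-φ⁻¹* (p , q) = cong (p ,_) (eq p q)
  where
  eq : ∀ p q → (q ℤ.- p) ℤ.+ p ≡ q
  eq = solve-∀

+φ-identityʳ : ∀ x → x +φ 0φ ≡ x
+φ-identityʳ (p , q) = cong₂ _,_ (ℤ.+-identityʳ p) (ℤ.+-identityʳ q)

+φ-−φ : ∀ x d → (x +φ d) −φ d ≡ x
+φ-−φ (p , q) (a , b) = cong₂ _,_ (eq p a) (eq q b)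
  where
  eq : ∀ p a → (p ℤ.+ a) ℤ.+ ℤ.- a ≡ p
  eq = solve-∀

−φ-+φ : ∀ x d → (x −φ d) +φ d ≡ x
−φ-+φ (p , q) (a , b) = cong₂ _,_ (eq p a) (eq q b)
  where
  eq : ∀ p a → (p ℤ.+ ℤ.- a) ℤ.+ a ≡ p
  eq = solve-∀

−φ-comm : ∀ x y z → (x −φ y) −φ z ≡ (x −φ z) −φ y
−φ-comm (p , q) (a , b) (c , d) = cong₂ _,_ (eq p a c) (eq q b d)
  where
  eq : ∀ p a c → (p ℤ.+ ℤ.- a) ℤ.+ ℤ.- c ≡ (p ℤ.+ ℤ.- c) ℤ.+ ℤ.- a
  eq = solve-∀

φ⁻¹*-−φ* : ∀ x d → φ⁻¹* (x −φ φ* d) ≡ φ⁻¹* x −φ d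
φ⁻¹*-−φ* (p , q) (a , b) = cong (_, p ℤ.+ ℤ.- b) (eq p q a b)
  where
  eq : ∀ p q a b → (q ℤ.+ ℤ.- (a ℤ.+ b)) ℤ.- (p ℤ.+ ℤ.- b) ≡ (q ℤ.- p) ℤ.+ ℤ.- a
  eq = solve-∀

+1φ-+1φ : ∀ x → (x +φ 1φ) +φ 1φ ≡ x +φ 2φ
+1φ-+1φ (p , q) = cong₂ _,_ (eq₁ p) (eq₂ q)
  where
  eq₁ : ∀ p → (p ℤ.+ 1ℤ) ℤ.+ 1ℤ ≡ p ℤ.+ 2ℤ
  eq₁ = solve-∀
  eq₂ : ∀ q → (q ℤ.+ 0ℤ) ℤ.+ 0ℤ ≡ q ℤ.+ 0ℤ
  eq₂ = solve-∀

φ*-+1φ : ∀ x → φ* (x +φ 1φ) ≡ (φ* x +φ 1φ) +φ gap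
φ*-+1φ (p , q) = cong₂ _,_ (eq₁ q) (eq₂ p q)
  where
  eq₁ : ∀ q → q ℤ.+ 0ℤ ≡ (q ℤ.+ 1ℤ) ℤ.+ -1ℤ
  eq₁ = solve-∀
  eq₂ : ∀ p q → (p ℤ.+ 1ℤ) ℤ.+ (q ℤ.+ 0ℤ) ≡ ((p ℤ.+ q) ℤ.+ 0ℤ) ℤ.+ 1ℤ
  eq₂ = solve-∀

φ*-+2φ : ∀ x → φ* (x +φ 2φ) ≡ (φ* (x +φ 1φ) +φ 1φ) +φ gap
φ*-+2φ x = trans (cong φ* (sym (+1φ-+1φ x))) (φ*-+1φ (x +φ 1φ))

φ*-+gap : ∀ x → φ* (x +φ gap) ≡ φ* x +φ 1φ
φ*-+gap (p , q) = cong (q ℤ.+ 1ℤ ,_) (eq p q)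
  where
  eq : ∀ p q → (p ℤ.+ -1ℤ) ℤ.+ (q ℤ.+ 1ℤ) ≡ (p ℤ.+ q) ℤ.+ 0ℤ
  eq = solve-∀

+gap-−φ : ∀ x → (x +φ gap) −φ x ≡ gap
+gap-−φ (p , q) = cong₂ _,_ (eq₁ p) (eq₂ q)
  where
  eq₁ : ∀ p → (p ℤ.+ -1ℤ) ℤ.+ ℤ.- p ≡ -1ℤ
  eq₁ = solve-∀
  eq₂ : ∀ q → (q ℤ.+ 1ℤ) ℤ.+ ℤ.- q ≡ 1ℤ
  eq₂ = solve-∀

infix 4 _≈_
_≈_ : GPoly → GPoly → Set
P ≈ Q = ∀ e → coeff e P ≡ coeff e Q

≈-setoid : Setoid _ _
≈-setoid = record
  { Carrier = GPoly
  ; _≈_ = _≈_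
  ; isEquivalence = record
    { refl = λ _ → refl
    ; sym = λ P≈Q e → sym (P≈Q e)
    ; trans = λ P≈Q Q≈R e → trans (P≈Q e) (Q≈R e)
    }
  }

module ≈-Reasoning = SetoidReasoning ≈-setoid

coeff-++ : ∀ e P Q → coeff e (P ++ Q) ≡ coeff e P + coeff e Q
coeff-++ e [] Q = refl
coeff-++ e ((c , x) ∷ P) Q with x ≟φ e
... | yes _ = trans (cong (c +_) (coeff-++ e P Q)) (sym (+-assoc c _ _))
... | no _ = coeff-++ e P Q

++-congˡ : ∀ R {P Q} → P ≈ Q → R ++ P ≈ R ++ Q
++-congˡ R {P} {Q} P≈Q e = begin
  coeff e (R ++ P)          ≡⟨ coeff-++ e R P ⟩
  coeff e R + coeff e P     ≡⟨ cong (coeff e R +_) (P≈Q e) ⟩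
  coeff e R + coeff e Q     ≡⟨ coeff-++ e R Q ⟨
  coeff e (R ++ Q)          ∎
  where open ≡-Reasoning

∷-++-move : ∀ t P Q → t ∷ (P ++ Q) ≈ P ++ t ∷ Q
∷-++-move t P Q e = begin
  coeff e ((t ∷ []) ++ P ++ Q)                    ≡⟨ coeff-++ e (t ∷ []) (P ++ Q) ⟩
  coeff e (t ∷ []) + coeff e (P ++ Q)             ≡⟨ cong (coeff e (t ∷ []) +_) (coeff-++ e P Q) ⟩
  coeff e (t ∷ []) + (coeff e P + coeff e Q)      ≡⟨ x∙yz≈y∙xz (coeff e (t ∷ [])) (coeff e P) (coeff e Q) ⟩
  coeff e P + (coeff e (t ∷ []) + coeff e Q)      ≡⟨ cong (coeff e P +_) (coeff-++ e (t ∷ []) Q) ⟨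
  coeff e P + coeff e (t ∷ Q)                     ≡⟨ coeff-++ e P (t ∷ Q) ⟨
  coeff e (P ++ t ∷ Q)                            ∎
  where open ≡-Reasoning

coeff-∷-≡ : ∀ {e x} c P → x ≡ e → coeff e ((c , x) ∷ P) ≡ c + coeff e P
coeff-∷-≡ {e} {x} c P x≡e with x ≟φ e
... | yes _ = refl
... | no x≢e = contradiction x≡e x≢e

coeff-∷-≢ : ∀ {e x} c P → ¬ x ≡ e → coeff e ((c , x) ∷ P) ≡ coeff e P
coeff-∷-≢ {e} {x} c P x≢e with x ≟φ e
... | yes x≡e = contradiction x≡e x≢e
... | no _ = refl

∷-split : ∀ m n x P → (m + n , x) ∷ P ≈ (m , x) ∷ (n , x) ∷ P
∷-split m n x P e with x ≟φ e
... | yes x≡e = trans (+-assoc m n _) (cong (m +_) (sym (coeff-∷-≡ n P x≡e)))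
... | no x≢e = sym (coeff-∷-≢ n P x≢e)

mapExp : (ℤφ → ℤφ) → GPoly → GPoly
mapExp f = map (map₂ f)

Inverses : (f g : ℤφ → ℤφ) → Set
Inverses f g = (∀ x → g (f x) ≡ x) × (∀ e → f (g e) ≡ e)

coeff-mapExp : ∀ {f g} → Inverses f g → ∀ e P → coeff e (mapExp f P) ≡ coeff (g e) P
coeff-mapExp inv e [] = refl
coeff-mapExp {f} {g} inv@(gf , fg) e ((c , x) ∷ P) with f x ≟φ e | x ≟φ g e
... | yes _ | yes _ = cong (c +_) (coeff-mapExp inv e P)
... | no _ | no _ = coeff-mapExp inv e P
... | yes fx≡e | no x≢ge = contradiction (trans (sym (gf x)) (cong g fx≡e)) x≢ge
... | no fx≢e | yes x≡ge = contradiction (trans (cong f x≡ge) (fg e)) fx≢e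

interleave : (f g : ℤφ → ℤφ) → GPoly → GPoly
interleave f g = concatMap (λ (c , x) → (c , f x) ∷ (c , g x) ∷ [])

interleave-≈ : ∀ f g P → interleave f g P ≈ mapExp f P ++ mapExp g P
interleave-≈ f g [] = λ _ → refl
interleave-≈ f g ((c , x) ∷ P) = begin
  (c , f x) ∷ (c , g x) ∷ interleave f g P            ≈⟨ ++-congˡ ((c , f x) ∷ (c , g x) ∷ []) (interleave-≈ f g P) ⟩
  (c , f x) ∷ (c , g x) ∷ (mapExp f P ++ mapExp g P)  ≈⟨ ++-congˡ ((c , f x) ∷ []) (∷-++-move (c , g x) (mapExp f P) (mapExp g P)) ⟩
  (c , f x) ∷ (mapExp f P ++ (c , g x) ∷ mapExp g P)  ∎
  where open ≈-Reasoning

coeff-interleave : ∀ {f f⁻¹ g g⁻¹} → Inverses f f⁻¹ → Inverses g g⁻¹ →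
                   ∀ e P → coeff e (interleave f g P) ≡ coeff (f⁻¹ e) P + coeff (g⁻¹ e) P
coeff-interleave {f} {_} {g} f-inv g-inv e P = begin
  coeff e (interleave f g P)                          ≡⟨ interleave-≈ f g P e ⟩
  coeff e (mapExp f P ++ mapExp g P)                  ≡⟨ coeff-++ e (mapExp f P) (mapExp g P) ⟩
  coeff e (mapExp f P) + coeff e (mapExp g P)         ≡⟨ cong₂ _+_ (coeff-mapExp f-inv e P) (coeff-mapExp g-inv e P) ⟩
  _                                                   ∎
  where open ≡-Reasoning

binomial : ℤφ → GPoly
binomial d = (1 , 0φ) ∷ (1 , d) ∷ []

*P-binomial : ∀ d P → P *P binomial d ≈ interleave id (_+φ d) P
*P-binomial d [] = λ _ → refl
*P-binomial d ((c , x) ∷ P) = begin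
  (c * 1 , x +φ 0φ) ∷ (c * 1 , x +φ d) ∷ (P *P binomial d)
    ≡⟨ cong₂ (λ c′ x′ → (c′ , x′) ∷ (c′ , x +φ d) ∷ (P *P binomial d)) (*-identityʳ c) (+φ-identityʳ x) ⟩
  (c , x) ∷ (c , x +φ d) ∷ (P *P binomial d)
    ≈⟨ ++-congˡ ((c , x) ∷ (c , x +φ d) ∷ []) (*P-binomial d P) ⟩
  (c , x) ∷ (c , x +φ d) ∷ interleave id (_+φ d) P   ∎
  where open ≈-Reasoning

coeff-*P-binomial : ∀ d e P → coeff e (P *P binomial d) ≡ coeff e P + coeff (e −φ d) P
coeff-*P-binomial d e P = trans (*P-binomial d P e)
  (coeff-interleave ((λ _ → refl) , (λ _ → refl)) ((λ x → +φ-−φ x d) , (λ e → −φ-+φ e d)) e P)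

*P-binomial-cong : ∀ d {P Q} → P ≈ Q → P *P binomial d ≈ Q *P binomial d
*P-binomial-cong d {P} {Q} P≈Q e = begin
  coeff e (P *P binomial d)              ≡⟨ coeff-*P-binomial d e P ⟩
  coeff e P + coeff (e −φ d) P           ≡⟨ cong₂ _+_ (P≈Q e) (P≈Q (e −φ d)) ⟩
  coeff e Q + coeff (e −φ d) Q           ≡⟨ coeff-*P-binomial d e Q ⟨
  coeff e (Q *P binomial d)              ∎
  where open ≡-Reasoning

-- step P = (1 + x) · P(x^φ)
step : GPoly → GPoly
step = interleave φ* (λ x → φ* x +φ 1φ)

coeff-step : ∀ e P → coeff e (step P) ≡ coeff (φ⁻¹* e) P + coeff (φ⁻¹* (e −φ 1φ)) P
coeff-step = coeff-interleave (φ⁻¹*-φ* , φ*-φ⁻¹*)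
  ((λ x → trans (cong φ⁻¹* (+φ-−φ (φ* x) 1φ)) (φ⁻¹*-φ* x)) , (λ e → trans (cong (_+φ 1φ) (φ*-φ⁻¹* (e −φ 1φ))) (−φ-+φ e 1φ)))

step-cong : ∀ {P Q} → P ≈ Q → step P ≈ step Q
step-cong {P} {Q} P≈Q e = begin
  coeff e (step P)                                         ≡⟨ coeff-step e P ⟩
  coeff (φ⁻¹* e) P + coeff (φ⁻¹* (e −φ 1φ)) P             ≡⟨ cong₂ _+_ (P≈Q _) (P≈Q _) ⟩
  coeff (φ⁻¹* e) Q + coeff (φ⁻¹* (e −φ 1φ)) Q             ≡⟨ coeff-step e Q ⟨
  coeff e (step Q)                                         ∎
  where open ≡-Reasoning

step-*P-binomial : ∀ d P → step (P *P binomial d) ≈ step P *P binomial (φ* d)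
step-*P-binomial d P e = begin
  coeff e (step (P *P binomial d))
    ≡⟨ coeff-step e (P *P binomial d) ⟩
  coeff e₀ (P *P binomial d) + coeff e₁ (P *P binomial d)
    ≡⟨ cong₂ _+_ (coeff-*P-binomial d e₀ P) (coeff-*P-binomial d e₁ P) ⟩
  (c e₀ + c (e₀ −φ d)) + (c e₁ + c (e₁ −φ d))
    ≡⟨ interchange (c e₀) _ _ _ ⟩
  (c e₀ + c e₁) + (c (e₀ −φ d) + c (e₁ −φ d))
    ≡⟨ cong₂ (λ u v → (c e₀ + c e₁) + (c u + c v)) (φ⁻¹*-−φ* e d) shifted ⟨
  (c e₀ + c e₁) + (c (φ⁻¹* (e −φ φ* d)) + c (φ⁻¹* ((e −φ φ* d) −φ 1φ)))
    ≡⟨ cong₂ _+_ (coeff-step e P) (coeff-step (e −φ φ* d) P) ⟨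
  coeff e (step P) + coeff (e −φ φ* d) (step P)
    ≡⟨ coeff-*P-binomial (φ* d) e (step P) ⟨
  coeff e (step P *P binomial (φ* d))
    ∎
  where
  open ≡-Reasoning
  c : ℤφ → ℕ
  c x = coeff x P
  e₀ e₁ : ℤφ
  e₀ = φ⁻¹* e
  e₁ = φ⁻¹* (e −φ 1φ)
  shifted : φ⁻¹* ((e −φ φ* d) −φ 1φ) ≡ e₁ −φ d
  shifted = trans (cong φ⁻¹* (−φ-comm e (φ* d) 1φ)) (φ⁻¹*-−φ* (e −φ 1φ) d)

G-suc : ∀ n → G (suc n) ≈ step (G n)
G-suc zero = λ _ → refl
G-suc (suc n) = begin
  G (suc n) *P binomial (φ^ (suc n))     ≈⟨ *P-binomial-cong (φ^ (suc n)) {G (suc n)} {step (G n)} (G-suc n) ⟩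
  step (G n) *P binomial (φ* (φ^ n))     ≈⟨ step-*P-binomial (φ^ n) (G n) ⟨
  step (G (suc n))                       ∎
  where open ≈-Reasoning

chain : ℤφ → List Coeffs → List Block
chain s [] = []
chain s (c ∷ cs) = block s c ∷ chain (maxExp (block s c) +φ gap) cs

-- refine cs gives the blocks of step (chain b cs), and carry p cs those of
-- p x^y + p x^(y+1) + step (chain b cs) with y + 1 = φ b: the tail of the image of a preceding
-- block, whose last term merges with the first term of the image of chain b cs.
carry : ℕ → List Coeffs → List Coeffs
carry p [] = two p p ∷ []
carry p (two c₁ c₂ ∷ cs) = three p (p + c₁) c₁ ∷ carry c₂ cs
carry p (three c₁ c₂ c₃ ∷ cs) = three p (p + c₁) c₁ ∷ two c₂ c₂ ∷ carry c₃ cs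

refine : List Coeffs → List Coeffs
refine [] = []
refine (two c₁ c₂ ∷ cs) = two c₁ c₁ ∷ carry c₂ cs
refine (three c₁ c₂ c₃ ∷ cs) = two c₁ c₁ ∷ two c₂ c₂ ∷ carry c₃ cs

infixr 5 _∷ᵉ_
_∷ᵉ_ : ∀ {c : ℕ} {x y : ℤφ} {P Q : GPoly} → x ≡ y → P ≡ Q → (c , x) ∷ P ≡ (c , y) ∷ Q
_∷ᵉ_ {c} x≡y P≡Q = cong₂ (λ x P → (c , x) ∷ P) x≡y P≡Q

carry-chain : ∀ p cs {y b} → y +φ 1φ ≡ φ* b →
  sumBlocks (chain y (carry p cs)) ≈ (p , y) ∷ (p , φ* b) ∷ step (sumBlocks (chain b cs))
carry-chain p [] {y} h e = cong (λ x → coeff e ((p , y) ∷ (p , x) ∷ [])) h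
carry-chain p (two c₁ c₂ ∷ cs) {y} {b} h = begin
  (p , y) ∷ (p + c₁ , y +φ 1φ) ∷ (c₁ , y +φ 2φ) ∷ sumBlocks (chain y′ (carry c₂ cs))
    ≈⟨ ++-congˡ ((p , y) ∷ (p + c₁ , y +φ 1φ) ∷ (c₁ , y +φ 2φ) ∷ []) (carry-chain c₂ cs h′) ⟩
  (p , y) ∷ (p + c₁ , y +φ 1φ) ∷ (c₁ , y +φ 2φ) ∷ (c₂ , y′) ∷ (c₂ , φ* b′) ∷ R
    ≡⟨ refl ∷ᵉ h ∷ᵉ e₁ ∷ᵉ e₂ ∷ᵉ φ*-+gap (b +φ 1φ) ∷ᵉ refl ⟩
  (p , y) ∷ (p + c₁ , φ* b) ∷ (c₁ , φ* b +φ 1φ) ∷ (c₂ , φ* (b +φ 1φ)) ∷ (c₂ , φ* (b +φ 1φ) +φ 1φ) ∷ R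
    ≈⟨ ++-congˡ ((p , y) ∷ []) (∷-split p c₁ (φ* b) _) ⟩
  (p , y) ∷ (p , φ* b) ∷ (c₁ , φ* b) ∷ (c₁ , φ* b +φ 1φ) ∷ (c₂ , φ* (b +φ 1φ)) ∷ (c₂ , φ* (b +φ 1φ) +φ 1φ) ∷ R
    ∎
  where
  open ≈-Reasoning
  y′ b′ : ℤφ
  y′ = (y +φ 2φ) +φ gap
  b′ = (b +φ 1φ) +φ gap
  R = step (sumBlocks (chain b′ cs))
  e₁ : y +φ 2φ ≡ φ* b +φ 1φ
  e₁ = trans (sym (+1φ-+1φ y)) (cong (_+φ 1φ) h)
  e₂ : y′ ≡ φ* (b +φ 1φ)
  e₂ = trans (cong (_+φ gap) e₁) (sym (φ*-+1φ b))
  h′ : y′ +φ 1φ ≡ φ* b′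
  h′ = trans (cong (_+φ 1φ) e₂) (sym (φ*-+gap (b +φ 1φ)))
carry-chain p (three c₁ c₂ c₃ ∷ cs) {y} {b} h = begin
  (p , y) ∷ (p + c₁ , y +φ 1φ) ∷ (c₁ , y +φ 2φ) ∷ (c₂ , z) ∷ (c₂ , z +φ 1φ) ∷ sumBlocks (chain y′ (carry c₃ cs))
    ≈⟨ ++-congˡ ((p , y) ∷ (p + c₁ , y +φ 1φ) ∷ (c₁ , y +φ 2φ) ∷ (c₂ , z) ∷ (c₂ , z +φ 1φ) ∷ []) (carry-chain c₃ cs h′) ⟩
  (p , y) ∷ (p + c₁ , y +φ 1φ) ∷ (c₁ , y +φ 2φ) ∷ (c₂ , z) ∷ (c₂ , z +φ 1φ) ∷ (c₃ , y′) ∷ (c₃ , φ* b′) ∷ R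
    ≡⟨ refl ∷ᵉ h ∷ᵉ e₁ ∷ᵉ e₂ ∷ᵉ cong (_+φ 1φ) e₂ ∷ᵉ e₃ ∷ᵉ φ*-+gap (b +φ 2φ) ∷ᵉ refl ⟩
  (p , y) ∷ (p + c₁ , φ* b) ∷ (c₁ , φ* b +φ 1φ) ∷ (c₂ , φ* (b +φ 1φ)) ∷ (c₂ , φ* (b +φ 1φ) +φ 1φ)
          ∷ (c₃ , φ* (b +φ 2φ)) ∷ (c₃ , φ* (b +φ 2φ) +φ 1φ) ∷ R
    ≈⟨ ++-congˡ ((p , y) ∷ []) (∷-split p c₁ (φ* b) _) ⟩
  (p , y) ∷ (p , φ* b) ∷ (c₁ , φ* b) ∷ (c₁ , φ* b +φ 1φ) ∷ (c₂ , φ* (b +φ 1φ)) ∷ (c₂ , φ* (b +φ 1φ) +φ 1φ)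
          ∷ (c₃ , φ* (b +φ 2φ)) ∷ (c₃ , φ* (b +φ 2φ) +φ 1φ) ∷ R
    ∎
  where
  open ≈-Reasoning
  z y′ b′ : ℤφ
  z = (y +φ 2φ) +φ gap
  y′ = (z +φ 1φ) +φ gap
  b′ = (b +φ 2φ) +φ gap
  R = step (sumBlocks (chain b′ cs))
  e₁ : y +φ 2φ ≡ φ* b +φ 1φ
  e₁ = trans (sym (+1φ-+1φ y)) (cong (_+φ 1φ) h)
  e₂ : z ≡ φ* (b +φ 1φ)
  e₂ = trans (cong (_+φ gap) e₁) (sym (φ*-+1φ b))
  e₃ : y′ ≡ φ* (b +φ 2φ)
  e₃ = trans (cong (λ u → (u +φ 1φ) +φ gap) e₂) (sym (φ*-+2φ b))
  h′ : y′ +φ 1φ ≡ φ* b′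
  h′ = trans (cong (_+φ 1φ) e₃) (sym (φ*-+gap (b +φ 2φ)))

step-chain : ∀ b cs → step (sumBlocks (chain b cs)) ≈ sumBlocks (chain (φ* b) (refine cs))
step-chain b [] = λ _ → refl
step-chain b (two c₁ c₂ ∷ cs) = begin
  (c₁ , φ* b) ∷ (c₁ , φ* b +φ 1φ) ∷ (c₂ , φ* (b +φ 1φ)) ∷ (c₂ , φ* (b +φ 1φ) +φ 1φ) ∷ R
    ≡⟨ refl ∷ᵉ refl ∷ᵉ φ*-+1φ b ∷ᵉ sym (φ*-+gap (b +φ 1φ)) ∷ᵉ refl ⟩
  (c₁ , φ* b) ∷ (c₁ , φ* b +φ 1φ) ∷ (c₂ , y) ∷ (c₂ , φ* b′) ∷ R
    ≈⟨ ++-congˡ ((c₁ , φ* b) ∷ (c₁ , φ* b +φ 1φ) ∷ []) (carry-chain c₂ cs h) ⟨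
  (c₁ , φ* b) ∷ (c₁ , φ* b +φ 1φ) ∷ sumBlocks (chain y (carry c₂ cs))
    ∎
  where
  open ≈-Reasoning
  y b′ : ℤφ
  y = (φ* b +φ 1φ) +φ gap
  b′ = (b +φ 1φ) +φ gap
  R = step (sumBlocks (chain b′ cs))
  h : y +φ 1φ ≡ φ* b′
  h = trans (cong (_+φ 1φ) (sym (φ*-+1φ b))) (sym (φ*-+gap (b +φ 1φ)))
step-chain b (three c₁ c₂ c₃ ∷ cs) = begin
  (c₁ , φ* b) ∷ (c₁ , φ* b +φ 1φ) ∷ (c₂ , φ* (b +φ 1φ)) ∷ (c₂ , φ* (b +φ 1φ) +φ 1φ)
              ∷ (c₃ , φ* (b +φ 2φ)) ∷ (c₃ , φ* (b +φ 2φ) +φ 1φ) ∷ R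
    ≡⟨ refl ∷ᵉ refl ∷ᵉ u-eq ∷ᵉ cong (_+φ 1φ) u-eq ∷ᵉ y-eq ∷ᵉ sym (φ*-+gap (b +φ 2φ)) ∷ᵉ refl ⟩
  (c₁ , φ* b) ∷ (c₁ , φ* b +φ 1φ) ∷ (c₂ , u) ∷ (c₂ , u +φ 1φ) ∷ (c₃ , y) ∷ (c₃ , φ* b′) ∷ R
    ≈⟨ ++-congˡ ((c₁ , φ* b) ∷ (c₁ , φ* b +φ 1φ) ∷ (c₂ , u) ∷ (c₂ , u +φ 1φ) ∷ []) (carry-chain c₃ cs h) ⟨
  (c₁ , φ* b) ∷ (c₁ , φ* b +φ 1φ) ∷ (c₂ , u) ∷ (c₂ , u +φ 1φ) ∷ sumBlocks (chain y (carry c₃ cs))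
    ∎
  where
  open ≈-Reasoning
  u y b′ : ℤφ
  u = (φ* b +φ 1φ) +φ gap
  y = (u +φ 1φ) +φ gap
  b′ = (b +φ 2φ) +φ gap
  R = step (sumBlocks (chain b′ cs))
  u-eq : φ* (b +φ 1φ) ≡ u
  u-eq = φ*-+1φ b
  y-eq : φ* (b +φ 2φ) ≡ y
  y-eq = trans (φ*-+2φ b) (cong (λ v → (v +φ 1φ) +φ gap) u-eq)
  h : y +φ 1φ ≡ φ* b′
  h = trans (cong (_+φ 1φ) (sym y-eq)) (sym (φ*-+gap (b +φ 2φ)))

-- the last case of IsPos, with u = -1 and q = 1
gap-positive : IsPos gap
gap-positive = inj₂ (inj₂ (inj₂ (ℤ.-<+ , ℤ.+<+ (s≤s z≤n) , ℤ.+<+ (s≤s (s≤s z≤n)))))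

<φ-+gap : ∀ x → x <φ (x +φ gap)
<φ-+gap x = subst IsPos (sym (+gap-−φ x)) gap-positive

chain-separated : ∀ s cs → Separated (chain s cs)
chain-separated s [] = tt
chain-separated s (c ∷ []) = tt
chain-separated s (c ∷ c′ ∷ cs) = <φ-+gap (maxExp (block s c)) , chain-separated _ (c′ ∷ cs)

chain-coeffs : ∀ s cs → map coeffs (chain s cs) ≡ cs
chain-coeffs s [] = refl
chain-coeffs s (c ∷ cs) = cong (c ∷_) (chain-coeffs _ cs)

chain-positive : ∀ s {cs} → All PositiveCoeffs cs → All (λ T → PositiveCoeffs (coeffs T)) (chain s cs)
chain-positive s {cs} pos = map⁻ (subst (All PositiveCoeffs) (sym (chain-coeffs s cs)) pos)

length-chain : ∀ s cs → length (chain s cs) ≡ length cs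
length-chain s cs = trans (sym (length-map coeffs (chain s cs))) (cong length (chain-coeffs s cs))

carry-positive : ∀ {p} cs → 0 < p → All PositiveCoeffs cs → All PositiveCoeffs (carry p cs)
carry-positive [] p>0 [] = (p>0 , p>0) ∷ []
carry-positive {p} (two c₁ _ ∷ cs) p>0 ((c₁>0 , c₂>0) ∷ pos) =
  (p>0 , <-≤-trans p>0 (m≤m+n p c₁) , c₁>0) ∷ carry-positive cs c₂>0 pos
carry-positive {p} (three c₁ _ _ ∷ cs) p>0 ((c₁>0 , c₂>0 , c₃>0) ∷ pos) =
  (p>0 , <-≤-trans p>0 (m≤m+n p c₁) , c₁>0) ∷ (c₂>0 , c₂>0) ∷ carry-positive cs c₃>0 pos

refine-positive : ∀ cs → All PositiveCoeffs cs → All PositiveCoeffs (refine cs)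
refine-positive [] [] = []
refine-positive (two _ _ ∷ cs) ((c₁>0 , c₂>0) ∷ pos) = (c₁>0 , c₁>0) ∷ carry-positive cs c₂>0 pos
refine-positive (three _ _ _ ∷ cs) ((c₁>0 , c₂>0 , c₃>0) ∷ pos) =
  (c₁>0 , c₁>0) ∷ (c₂>0 , c₂>0) ∷ carry-positive cs c₃>0 pos

twos threes : List Coeffs → ℕ
twos [] = 0
twos (two _ _ ∷ cs) = suc (twos cs)
twos (three _ _ _ ∷ cs) = twos cs
threes [] = 0
threes (two _ _ ∷ cs) = threes cs
threes (three _ _ _ ∷ cs) = suc (threes cs)

length≡twos+threes : ∀ cs → length cs ≡ twos cs + threes cs
length≡twos+threes [] = refl
length≡twos+threes (two _ _ ∷ cs) = cong suc (length≡twos+threes cs)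
length≡twos+threes (three _ _ _ ∷ cs) = trans (cong suc (length≡twos+threes cs)) (sym (+-suc (twos cs) (threes cs)))

carry-twos : ∀ p cs → twos (carry p cs) ≡ suc (threes cs)
carry-twos p [] = refl
carry-twos p (two _ c₂ ∷ cs) = carry-twos c₂ cs
carry-twos p (three _ _ c₃ ∷ cs) = cong suc (carry-twos c₃ cs)

carry-threes : ∀ p cs → threes (carry p cs) ≡ length cs
carry-threes p [] = refl
carry-threes p (two _ c₂ ∷ cs) = cong suc (carry-threes c₂ cs)
carry-threes p (three _ _ c₃ ∷ cs) = cong suc (carry-threes c₃ cs)

refine-counts : ∀ {a b} cs → twos cs ≡ suc a → suc (threes cs) ≡ b →
                twos (refine cs) ≡ suc b × suc (threes (refine cs)) ≡ a + b
refine-counts [] () _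
refine-counts {a} {b} (two _ c₂ ∷ cs) twos≡ threes≡ =
  cong suc (trans (carry-twos c₂ cs) threes≡) ,
  (begin
    suc (threes (carry c₂ cs))      ≡⟨ cong suc (trans (carry-threes c₂ cs) (length≡twos+threes cs)) ⟩
    suc (twos cs + threes cs)       ≡⟨ cong (_+ threes cs) twos≡ ⟩
    suc a + threes cs               ≡⟨ +-suc a (threes cs) ⟨
    a + suc (threes cs)             ≡⟨ cong (a +_) threes≡ ⟩
    a + b                           ∎)
  where open ≡-Reasoning
refine-counts {a} {b} (three _ _ c₃ ∷ cs) twos≡ threes≡ =
  cong suc (trans (cong suc (carry-twos c₃ cs)) threes≡) ,
  (begin
    suc (threes (carry c₃ cs))      ≡⟨ cong suc (trans (carry-threes c₃ cs) (length≡twos+threes cs)) ⟩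
    suc (twos cs + threes cs)       ≡⟨ cong (λ n → suc (n + threes cs)) twos≡ ⟩
    suc (suc a + threes cs)         ≡⟨ cong suc (+-suc a (threes cs)) ⟨
    suc (a + suc (threes cs))       ≡⟨ +-suc a (suc (threes cs)) ⟨
    a + suc (suc (threes cs))       ≡⟨ cong (a +_) threes≡ ⟩
    a + b                           ∎)
  where open ≡-Reasoning

blocksOf : ℕ → List Coeffs
blocksOf zero = two 1 1 ∷ []
blocksOf (suc m) = refine (blocksOf m)

blocksOf-counts : ∀ m → twos (blocksOf m) ≡ suc (fib m) × suc (threes (blocksOf m)) ≡ fib (suc m)
blocksOf-counts zero = refl , refl
blocksOf-counts (suc m) with refine-counts (blocksOf m) (proj₁ (blocksOf-counts m)) (proj₂ (blocksOf-counts m))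
... | twos≡ , threes≡ = twos≡ , trans threes≡ (+-comm (fib m) (fib (suc m)))

length-blocksOf : ∀ m → length (blocksOf m) ≡ fib (suc (suc m))
length-blocksOf m = begin
  length (blocksOf m)                         ≡⟨ length≡twos+threes (blocksOf m) ⟩
  twos (blocksOf m) + threes (blocksOf m)     ≡⟨ cong (_+ threes (blocksOf m)) twos≡ ⟩
  suc (fib m) + threes (blocksOf m)           ≡⟨ +-suc (fib m) _ ⟨
  fib m + suc (threes (blocksOf m))           ≡⟨ cong (fib m +_) threes≡ ⟩
  fib m + fib (suc m)                         ≡⟨ +-comm (fib m) (fib (suc m)) ⟩
  fib (suc (suc m))                           ∎
  where
  open ≡-Reasoning
  twos≡ = proj₁ (blocksOf-counts m)
  threes≡ = proj₂ (blocksOf-counts m)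

blocksOf-positive : ∀ m → All PositiveCoeffs (blocksOf m)
blocksOf-positive zero = (s≤s z≤n , s≤s z≤n) ∷ []
blocksOf-positive (suc m) = refine-positive (blocksOf m) (blocksOf-positive m)

G-blocks : ∀ m → G (suc m) ≈ sumBlocks (chain 0φ (blocksOf m))
G-blocks zero = λ _ → refl
G-blocks (suc m) = begin
  G (suc (suc m))                            ≈⟨ G-suc (suc m) ⟩
  step (G (suc m))                           ≈⟨ step-cong {G (suc m)} {sumBlocks (chain 0φ (blocksOf m))} (G-blocks m) ⟩
  step (sumBlocks (chain 0φ (blocksOf m)))   ≈⟨ step-chain 0φ (blocksOf m) ⟩
  sumBlocks (chain 0φ (blocksOf (suc m)))    ∎
  where open ≈-Reasoning

theorem2 : (n : ℕ) → 1 ≤ n →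
    ∃[ Ts ] (All (λ T → PositiveCoeffs (coeffs T)) Ts
             × Separated Ts
             × (∀ e → coeff e (G n) ≡ coeff e (sumBlocks Ts))
             × length Ts ≡ fib (suc n))
theorem2 (suc m) _ =
  chain 0φ (blocksOf m) ,
  chain-positive 0φ (blocksOf-positive m) ,
  chain-separated 0φ (blocksOf m) ,
  G-blocks m ,
  trans (length-chain 0φ (blocksOf m)) (length-blocksOf m)
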